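{- Let $k<n$ be positive integers. Then $$\gamma_{\times k,t}^{r}(K_n)=\begin{cases} n & \text{if } n\le 2k+1,\\ k+1 & \text{otherwise.}\end{cases}$$
   Context: All graphs are finite and simple; $N(x)$ denotes the open neighborhood of $x$, and $\delta(G)$ the minimum degree. For an integer $k\ge 1$, a set $S\subseteq V(G)$ is a $k$-tuple total dominating set of $G$ if $|N(x)\cap S|\ge k$ for every $x\in V(G)$. It is a $k$-tuple total restrained dominating set (kTRDS) if moreover every vertex $x\in V(G)\setminus S$ is adjacent to at least $k$ vertices of $V(G)\setminus S$. For a graph with $\delta(G)\ge k$, $\gamma_{\times k,t}^{r}(G)$ denotes the minimum cardinality of a kTRDS of $G$. $K_n$ is the complete graph on $n$ vertices. -}

module Defs where

open import Data.Nat using (ℕ; _≤_; _≥_)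
open import Data.Fin using (Fin)
open import Data.Fin.Subset using (Subset; _∈_; _∉_; ∣_∣; ∁)
open import Data.Fin.Subset.Properties using (_∈?_)
open import Data.Product using (Σ; _×_; _,_)
open import Relation.Binary.PropositionalEquality using (_≡_)
open import Relation.Nullary using (¬_; Dec; yes; no)
open import Data.List using (List; filter; length)
open import Data.List using () renaming (List to L)
open import Data.Fin.Base using ()
open import Data.List.Base using ()
open import Data.Fin using (_≟_)
open import Relation.Nullary.Decidable using (_×-dec_; ¬?)
open import Data.List using (allFin)

record Graph (n : ℕ) : Set₁ where
  field
    Adj     : Fin n → Fin n → Set
    adj?    : (x y : Fin n) → Dec (Adj x y)
    sym     : ∀ {x y} → Adj x y → Adj y x
    irrefl  : ∀ {x} → ¬ Adj x x
open Graph public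

nbrCount : ∀ {n} → Graph n → Fin n → Subset n → ℕ
nbrCount G x S = length (filter (λ y → adj? G x y ×-dec (y ∈? S)) (allFin _))

IsKTRDS : ∀ {n} → Graph n → ℕ → Subset n → Set
IsKTRDS {n} G k S =
  (∀ (x : Fin n) → k ≤ nbrCount G x S) ×
  (∀ (x : Fin n) → x ∉ S → k ≤ nbrCount G x (∁ S))

KTRDNumberIs : ∀ {n} → Graph n → ℕ → ℕ → Set
KTRDNumberIs {n} G k m =
  (Σ (Subset n) λ S → IsKTRDS G k S × ∣ S ∣ ≡ m) ×
  (∀ (S : Subset n) → IsKTRDS G k S → m ≤ ∣ S ∣)

complete : (n : ℕ) → Graph n
complete n = record
  { Adj = λ x y → ¬ x ≡ y
  ; adj? = λ x y → ¬? (x ≟ y)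
  ; sym = λ p q → p (Relation.Binary.PropositionalEquality.sym q)
  ; irrefl = λ p → p Relation.Binary.PropositionalEquality.refl
  }

-- In K_n every vertex x sees all of S except possibly itself, so
-- |N(x) ∩ S| is |S| − 1 or |S| according as x ∈ S or not.  Hence S is a
-- k-tuple total restrained dominating set exactly when |S| ≥ k + 1 and, if
-- V ∖ S ≠ ∅, also |V ∖ S| ≥ k + 1.  Since |S| + |V ∖ S| = n, a proper such S
-- exists iff n ≥ 2k + 2, and then the smallest has k + 1 vertices; otherwise
-- only S = V qualifies.
module Submission where

open import Defs hiding (sym)
open import Data.Nat using (ℕ; zero; suc; _+_; _*_; _∸_; _≤_; _<_; _>_; z≤n; s≤s)
open import Data.Nat.Properties
  using (module ≤-Reasoning; ≤-reflexive; ≤-trans; <⇒≱; >⇒≢; +-comm; +-assoc; +-identityʳ;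
         +-mono-≤; +-monoʳ-≤; +-cancelʳ-≤; ∸-monoˡ-≤; m≤m+n; m+n∸m≡n; m+[n∸m]≡n)
open import Data.Nat.Tactic.RingSolver using (solve-∀)
open import Data.Bool using (Bool; true; false; not; _∧_)
open import Data.Fin using (Fin; zero; suc; _≟_)
open import Data.Fin.Subset
  using (Subset; _∈_; _∉_; ∣_∣; ∁; ⊤; ⊥; inside; outside; Nonempty)
open import Data.Fin.Subset.Properties
  using (_∈?_; ∈⊤; ∣⊤∣≡n; ∣⊥∣≡0; x∈∁p⇒x∉p; ∣∁p∣≡n∸∣p∣; ∣p∣≤n; nonempty?; Empty-unique)
open import Data.List using (filter; length; tabulate)
open import Data.Vec using ([]; _∷_)
open import Data.Product using (∃; _,_; _×_)
open import Function using (_∘_; id)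
open import Relation.Binary.PropositionalEquality using (_≡_; refl; sym; trans; cong; subst; module ≡-Reasoning)
open import Relation.Nullary using (yes; no; does; contradiction)
open import Relation.Nullary.Decidable using (dec-true; _×-dec_)
open import Relation.Unary using (Pred; Decidable)

private
  variable
    n k : ℕ

indicator : Bool → ℕ
indicator true  = 1
indicator false = 0

indicator≤1 : ∀ b → indicator b ≤ 1
indicator≤1 true  = s≤s z≤n
indicator≤1 false = z≤n

count : (Fin n → Bool) → ℕ
count {zero}  b = 0
count {suc n} b = indicator (b zero) + count (b ∘ suc)

length-filter-tabulate : ∀ {a p} {A : Set a} {P : Pred A p} (P? : Decidable P) (f : Fin n → A) →
                         length (filter P? (tabulate f)) ≡ count (does ∘ P? ∘ f)
length-filter-tabulate {zero}  P? f = refl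
length-filter-tabulate {suc n} P? f with does (P? (f zero))
... | true  = cong suc (length-filter-tabulate P? (f ∘ suc))
... | false = length-filter-tabulate P? (f ∘ suc)

∣p∣≡count-∈ : (p : Subset n) → ∣ p ∣ ≡ count (λ y → does (y ∈? p))
∣p∣≡count-∈ []            = refl
∣p∣≡count-∈ (inside  ∷ p) = cong suc (∣p∣≡count-∈ p)
∣p∣≡count-∈ (outside ∷ p) = ∣p∣≡count-∈ p

count-without+indicator : (x : Fin n) (b : Fin n → Bool) →
                          count (λ y → not (does (x ≟ y)) ∧ b y) + indicator (b x) ≡ count b
count-without+indicator zero    b = +-comm (count (b ∘ suc)) (indicator (b zero))
count-without+indicator (suc x) b =
  trans (+-assoc (indicator (b zero)) _ _) (cong (indicator (b zero) +_) (count-without+indicator x (b ∘ suc)))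

∣p∣+∣∁p∣≡n : (p : Subset n) → ∣ p ∣ + ∣ ∁ p ∣ ≡ n
∣p∣+∣∁p∣≡n p = trans (cong (∣ p ∣ +_) (∣∁p∣≡n∸∣p∣ p)) (m+[n∸m]≡n (∣p∣≤n p))

∣p∣>0⇒Nonempty : {n : ℕ} (p : Subset n) → 0 < ∣ p ∣ → Nonempty p
∣p∣>0⇒Nonempty {n} p 0<∣p∣ with nonempty? p
... | yes ne = ne
... | no ¬ne = contradiction (trans (cong ∣_∣ (Empty-unique ¬ne)) (∣⊥∣≡0 n)) (>⇒≢ 0<∣p∣)

∃-subset-of-size : ∀ {m} → m ≤ n → ∃ λ (p : Subset n) → ∣ p ∣ ≡ m
∃-subset-of-size {n} z≤n = ⊥ , ∣⊥∣≡0 n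
∃-subset-of-size (s≤s m≤n) with ∃-subset-of-size m≤n
... | p , ∣p∣≡m = inside ∷ p , cong suc ∣p∣≡m

nbrCount-complete : (x : Fin n) (S : Subset n) →
                    nbrCount (complete n) x S + indicator (does (x ∈? S)) ≡ ∣ S ∣
nbrCount-complete {n} x S =
  trans (cong (_+ indicator (does (x ∈? S))) (length-filter-tabulate (λ y → adj? (complete n) x y ×-dec (y ∈? S)) id))
        (trans (count-without+indicator x (λ y → does (y ∈? S))) (sym (∣p∣≡count-∈ S)))

nbrCount-complete-≤ : (x : Fin n) (S : Subset n) → nbrCount (complete n) x S ≤ ∣ S ∣
nbrCount-complete-≤ x S =
  subst (nbrCount (complete _) x S ≤_) (nbrCount-complete x S) (m≤m+n _ (indicator (does (x ∈? S))))

∈⇒nbrCount-complete : {x : Fin n} {S : Subset n} → x ∈ S → suc (nbrCount (complete n) x S) ≡ ∣ S ∣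
∈⇒nbrCount-complete {x = x} {S} x∈S = trans (+-comm 1 _)
  (subst (λ b → nbrCount (complete _) x S + indicator b ≡ ∣ S ∣) (dec-true (x ∈? S) x∈S) (nbrCount-complete x S))

<∣S∣⇒≤nbrCount-complete : (x : Fin n) (S : Subset n) → k < ∣ S ∣ → k ≤ nbrCount (complete n) x S
<∣S∣⇒≤nbrCount-complete {k = k} x S k<∣S∣ = +-cancelʳ-≤ 1 k _ (begin
  k + 1                                                  ≡⟨ +-comm k 1 ⟩
  suc k                                                  ≤⟨ k<∣S∣ ⟩
  ∣ S ∣                                                  ≡⟨ sym (nbrCount-complete x S) ⟩
  nbrCount (complete _) x S + indicator (does (x ∈? S))  ≤⟨ +-monoʳ-≤ _ (indicator≤1 _) ⟩
  nbrCount (complete _) x S + 1                          ∎)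
  where open ≤-Reasoning

-- The vertex zero supplies k ≤ |S| neighbours in S, so S has some element x,
-- and x itself has k neighbours in S.
ktrds-complete-card : {S : Subset (suc n)} → 1 ≤ k → IsKTRDS (complete (suc n)) k S → k < ∣ S ∣
ktrds-complete-card {k = k} {S = S} 1≤k (dom , _)
  with ∣p∣>0⇒Nonempty S (≤-trans 1≤k (≤-trans (dom zero) (nbrCount-complete-≤ zero S)))
... | x , x∈S = subst (k <_) (∈⇒nbrCount-complete x∈S) (s≤s (dom x))

ktrds-complete-∁-card : {S : Subset n} → IsKTRDS (complete n) k S → Nonempty (∁ S) → k < ∣ ∁ S ∣
ktrds-complete-∁-card {k = k} (_ , restrained) (x , x∈∁S) =
  subst (k <_) (∈⇒nbrCount-complete x∈∁S) (s≤s (restrained x (x∈∁p⇒x∉p x∈∁S)))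

complete-ktrds : {S : Subset n} → k < ∣ S ∣ → (∀ x → x ∉ S → k < ∣ ∁ S ∣) → IsKTRDS (complete n) k S
complete-ktrds {S = S} k<∣S∣ k<∣∁S∣ =
    (λ x → <∣S∣⇒≤nbrCount-complete x S k<∣S∣)
  , (λ x x∉S → <∣S∣⇒≤nbrCount-complete x (∁ S) (k<∣∁S∣ x x∉S))

suc-k+suc-k≡suc[2k+1] : ∀ k → suc k + suc k ≡ suc (2 * k + 1)
suc-k+suc-k≡suc[2k+1] = solve-∀

ktrds-complete-full : {S : Subset (suc n)} → 1 ≤ k → suc n ≤ 2 * k + 1 →
                      IsKTRDS (complete (suc n)) k S → ∣ S ∣ ≡ suc n
ktrds-complete-full {n} {k} {S} 1≤k n≤2k+1 S-ktrds with nonempty? (∁ S)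
... | yes ∁S≠∅ = contradiction n≤2k+1 (<⇒≱ 2k+1<n)
  where
  open ≤-Reasoning
  2k+1<n : 2 * k + 1 < suc n
  2k+1<n = begin
    suc (2 * k + 1)   ≡⟨ sym (suc-k+suc-k≡suc[2k+1] k) ⟩
    suc k + suc k     ≤⟨ +-mono-≤ (ktrds-complete-card 1≤k S-ktrds) (ktrds-complete-∁-card S-ktrds ∁S≠∅) ⟩
    ∣ S ∣ + ∣ ∁ S ∣   ≡⟨ ∣p∣+∣∁p∣≡n S ⟩
    suc n             ∎
... | no ∁S=∅ = begin
  ∣ S ∣             ≡⟨ sym (+-identityʳ _) ⟩
  ∣ S ∣ + 0         ≡⟨ cong (∣ S ∣ +_) (sym (trans (cong ∣_∣ (Empty-unique ∁S=∅)) (∣⊥∣≡0 (suc n)))) ⟩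
  ∣ S ∣ + ∣ ∁ S ∣   ≡⟨ ∣p∣+∣∁p∣≡n S ⟩
  suc n             ∎
  where open ≡-Reasoning

2k+1<n⇒k<n∸[1+k] : ∀ {n} → 2 * k + 1 < n → k < n ∸ suc k
2k+1<n⇒k<n∸[1+k] {k} {n} 2k+1<n = subst (_≤ n ∸ suc k) (m+n∸m≡n (suc k) (suc k))
  (∸-monoˡ-≤ (suc k) (subst (_≤ n) (sym (suc-k+suc-k≡suc[2k+1] k)) 2k+1<n))

proposition2p1 : (k n : ℕ) → 1 ≤ k → k < n →
    (n ≤ 2 * k + 1 → KTRDNumberIs (complete n) k n) ×
    (n > 2 * k + 1 → KTRDNumberIs (complete n) k (k + 1))
proposition2p1 k zero    _   ()
proposition2p1 k (suc n) 1≤k k<n = small , large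
  where
  small : suc n ≤ 2 * k + 1 → KTRDNumberIs (complete (suc n)) k (suc n)
  small n≤2k+1 =
      (⊤ , complete-ktrds (subst (k <_) (sym (∣⊤∣≡n _)) k<n) (λ _ x∉⊤ → contradiction ∈⊤ x∉⊤) , ∣⊤∣≡n _)
    , λ S S-ktrds → ≤-reflexive (sym (ktrds-complete-full 1≤k n≤2k+1 S-ktrds))

  large : suc n > 2 * k + 1 → KTRDNumberIs (complete (suc n)) k (k + 1)
  large 2k+1<n with ∃-subset-of-size k<n
  ... | S , ∣S∣≡1+k =
      (S , complete-ktrds (≤-reflexive (sym ∣S∣≡1+k)) (λ _ _ → k<∣∁S∣) , trans ∣S∣≡1+k (+-comm 1 k))
    , λ S′ S′-ktrds → subst (_≤ ∣ S′ ∣) (+-comm 1 k) (ktrds-complete-card 1≤k S′-ktrds)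
    where
    k<∣∁S∣ : k < ∣ ∁ S ∣
    k<∣∁S∣ = subst (k <_) (sym (trans (∣∁p∣≡n∸∣p∣ S) (cong (suc n ∸_) ∣S∣≡1+k))) (2k+1<n⇒k<n∸[1+k] 2k+1<n)
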